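{- Let $\beta=(E,\#,\mapsto,l)$ be a Bundle Event Structure and let $\lessdot'\subseteq\lessdot\subseteq E\times E$ be acyclic relations, so that $(\beta,\lessdot)$ and $(\beta,\lessdot')$ are prioritized Bundle Event Structures. Then $\mathrm{Traces}(\beta,\lessdot)\subseteq\mathrm{Traces}(\beta,\lessdot')$.
   Context: A Bundle Event Structure (BES) is a quadruple $\beta=(E,\#,\mapsto,l)$ where $E$ is a set of events, $\#\subseteq E\times E$ is an irreflexive symmetric relation (conflict), $\mapsto\subseteq\mathcal{P}(E)\times E$ is the enabling relation (a pair $(X,e)$ is written $X\mapsto e$), and $l:E\to Act$ is a labeling function, satisfying Stability: whenever $X\mapsto e$, any two distinct $e_1,e_2\in X$ satisfy $e_1\# e_2$. For a finite sequence $\sigma=e_1\cdots e_n$ of events write $\bar\sigma=\{e_1,\dots,e_n\}$ and $\sigma_i=e_1\cdots e_i$ ($\sigma_0$ empty). Define $\mathrm{en}_\beta(\sigma)=\{e\in E\setminus\bar\sigma\mid (\forall X\subseteq E.\ X\mapsto e\Rightarrow X\cap\bar\sigma\neq\emptyset)\wedge\neg\exists e'\in\bar\sigma.\ e\# e'\}$. $\sigma$ is a trace of $\beta$ iff $e_i\in\mathrm{en}_\beta(\sigma_{i-1})$ for all $1\le i\le n$. A prioritized BES (PBES) is a pair $(\beta,\lessdot)$ with $\lessdot\subseteq E\times E$ acyclic ($e\lessdot e'$: $e'$ has higher priority). $\sigma=e_1\cdots e_n$ is a trace of $(\beta,\lessdot)$ iff $\sigma$ is a trace of $\beta$ and for all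 $0\le i<n$ and all $e_j,e_h\in\bar\sigma$ with $e_j\neq e_h$, $e_j,e_h\in\mathrm{en}_\beta(\sigma_i)$ and $e_h\lessdot e_j$, we have $j<h$; $\mathrm{Traces}(\beta,\lessdot)$ is the set of these traces. -}

module Defs where

open import Level using (Level; _⊔_; suc)
open import Data.Nat using (ℕ; _<_)
open import Data.Fin using (Fin; toℕ)
open import Data.List using (List; []; _∷_; length; lookup; take)
open import Data.List.Membership.Propositional using (_∈_; _∉_)
open import Data.Product using (_×_; Σ; ∃; ∃-syntax; _,_)
open import Relation.Binary.PropositionalEquality using (_≡_; _≢_)
open import Relation.Binary.Construct.Closure.Transitive using (TransClosure)
open import Relation.Nullary using (¬_)

Pred : Set → Set₁
Pred E = E → Set

record BES (E : Set) (Act : Set) : Set₁ where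
  field
    _#_      : E → E → Set
    #-irrefl : ∀ e → ¬ (e # e)
    #-sym    : ∀ {e e'} → e # e' → e' # e
    _↦_      : Pred E → E → Set
    l        : E → Act
    stability : ∀ {X e} → X ↦ e → ∀ e₁ e₂ → X e₁ → X e₂ → e₁ ≢ e₂ → e₁ # e₂

module _ {E Act : Set} (β : BES E Act) where
  open BES β

  en : List E → E → Set₁
  en σ e = (e ∉ σ)
         × (∀ (X : Pred E) → X ↦ e → ∃[ x ] (X x × x ∈ σ))
         × ¬ (∃[ e' ] (e' ∈ σ × e # e'))

  IsTrace : List E → Set₁
  IsTrace σ = ∀ (i : Fin (length σ)) → en (take (toℕ i) σ) (lookup σ i)

  -- σ is a trace of the PBES (β, ⋖)   (e ⋖ e' : e' has higher priority)
  -- positions are 0-based here: event e_{j+1} of the paper is lookup σ j,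
  -- and σ_i = take i σ for 0 ≤ i < n.
  IsPTrace : (E → E → Set) → List E → Set₁
  IsPTrace _⋖_ σ =
    IsTrace σ ×
    (∀ (i : ℕ) → i < length σ →
     ∀ (j h : Fin (length σ)) →
       lookup σ j ≢ lookup σ h →
       en (take i σ) (lookup σ j) →
       en (take i σ) (lookup σ h) →
       lookup σ h ⋖ lookup σ j →
       toℕ j < toℕ h)

  Traces : (E → E → Set) → List E → Set₁
  Traces _⋖_ σ = IsPTrace _⋖_ σ

Acyclic : {E : Set} → (E → E → Set) → Set
Acyclic {E} R = ∀ (e : E) → ¬ TransClosure R e e

_⊆ᴿ_ : {E : Set} → (E → E → Set) → (E → E → Set) → Set
R ⊆ᴿ S = ∀ {a b} → R a b → S a b

_⊆ᴾ_ : {A : Set} → (A → Set₁) → (A → Set₁) → Set₁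
P ⊆ᴾ Q = ∀ {a} → P a → Q a

module Submission where

open import Defs
open import Data.Product using (_,_)

-- Weakening the priority relation only removes constraints on traces.
IsPTrace-antitone : ∀ {E Act : Set} (β : BES E Act) {_⋖_ _⋖′_ : E → E → Set} →
                    _⋖′_ ⊆ᴿ _⋖_ → IsPTrace β _⋖_ ⊆ᴾ IsPTrace β _⋖′_
IsPTrace-antitone β ⋖′⊆⋖ (trace , respects-⋖) =
  trace , λ i i<n j h distinct j-enabled h-enabled h⋖′j →
    respects-⋖ i i<n j h distinct j-enabled h-enabled (⋖′⊆⋖ h⋖′j)

lemma2 : ∀ {E Act : Set} (β : BES E Act) (_⋖_ _⋖′_ : E → E → Set) →
         Acyclic _⋖_ → Acyclic _⋖′_ → _⋖′_ ⊆ᴿ _⋖_ →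
         Traces β _⋖_ ⊆ᴾ Traces β _⋖′_
lemma2 β _ _ _ _ = IsPTrace-antitone β
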